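{- Let $\mu\subseteq\lambda$ be partitions and let $X_\mu^\lambda$ and $\Phi$ be as defined in the context. For $T=(T^{(1)},\dots,T^{(\ell(T))})\in X_\mu^\lambda$, $T$ is a fixed point of $\Phi$ if and only if both of the following hold: (F1) $\ell(T)=|\lambda|-|\mu|$, i.e. $|T^{(i)}|=1$ for all $i$; and (F2) if the cells of $T$ are enumerated as $c_1<c_2<\cdots<c_{\ell(T)}$ in the total order, then $c_{\ell(T)-i+1}\in T^{(i)}$ for all $i$.
   Context: Partitions are identified with their Young diagrams (English convention, cell $(i,j)$ in row $i$, column $j$). For partitions $\mu\subseteq\lambda$, let $\mathcal{C}_\mu^\lambda$ be the set of all chains $(\lambda_0,\dots,\lambda_k)$, $k\ge 0$, of partitions with $\mu=\lambda_0\subsetneq\lambda_1\subsetneq\cdots\subsetneq\lambda_k=\lambda$. Let $X_\mu^\lambda$ be the disjoint union over such chains of $\prod_{i=1}^k \mathrm{SSYT}(\lambda_i/\lambda_{i-1})$, where $\mathrm{SSYT}(\nu/\rho)$ is the set of semistandard Young tableaux (rows weakly increasing left to right, columns strictly increasing top to bottom, positive integer entries) of skew shape $\nu/\rho$. For $T=(T^{(1)},\dots,T^{(k)})\in X_\mu^\lambda$, its length is $\ell(T)=k$. Concatenating the $T^{(i)}$ gives a filling (also denoted $T$) of $\lambda/\mu$, not necessarily semistandard; each $T^{(i)}$ is regarded as a set of cells with entries, and $|\lambda|$ denotes the number of cells of $\lambda$. Total order on cells of $T$: for cells $c=(i,j)$, $c'=(i',j')$, $c<c'$ iff $T(c)<T(c')$,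 or $T(c)=T(c')$ and $j<j'$, or $T(c)=T(c')$, $j=j'$ and $i>i'$, where $T(c)$ is the entry of cell $c$. A cell $c\in T^{(i)}$ is splittable if $|T^{(i)}|>1$ and $c$ is the largest cell of $T^{(i)}$; it is mergeable if $i>1$, $|T^{(i)}|=1$, the union $T^{(i-1)}\sqcup T^{(i)}$ is a semistandard tableau, and $c$ is larger than every cell of $T^{(i-1)}$. Let $\mathrm{cell}(T)$ be the largest cell that is splittable or mergeable, or $\emptyset$ if none exists; $T$ is called splittable (resp. mergeable) if $\mathrm{cell}(T)$ is splittable (resp. mergeable). Define $\Phi(T)$: if $T$ is splittable with $\mathrm{cell}(T)\in T^{(i)}$, $\Phi(T)=(T^{(1)},\dots,T^{(i-1)},T^{(i)}\setminus\{\mathrm{cell}(T)\},T',T^{(i+1)},\dots,T^{(k)})$ where $T'$ is the one-cell tableau consisting of $\mathrm{cell}(T)$ with its entry; if $T$ is mergeable with $\mathrm{cell}(T)\in T^{(i)}$, $\Phi(T)=(T^{(1)},\dots,T^{(i-2)},T^{(i-1)}\sqcup T^{(i)},T^{(i+1)},\dots,T^{(k)})$; if $\mathrm{cell}(T)=\emptyset$, $\Phi(T)=T$. -}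

module Defs where

open import Data.Nat using (ℕ; zero; suc; _<_; _≤_; _≥_; _≟_)
open import Data.Nat.Properties using ()
open import Data.List using (List; []; _∷_; map; length; concat; filter; _++_)
open import Data.Nat.ListAction using (sum)
open import Data.List.Relation.Unary.All using (All)
open import Data.List.Relation.Unary.Unique.Propositional using (Unique)
open import Data.List.Relation.Unary.Linked using (Linked)
open import Data.List.Relation.Binary.Permutation.Propositional using (_↭_)
open import Data.List.Relation.Binary.Pointwise using (Pointwise)
open import Data.List.Membership.Propositional using (_∈_)
open import Data.Maybe using (Maybe; just; nothing)
open import Data.Product using (Σ; Σ-syntax; _×_; _,_)
open import Data.Product.Properties using (≡-dec)
open import Data.Sum using (_⊎_)
open import Relation.Nullary using (¬_; ¬?)
open import Relation.Binary.PropositionalEquality using (_≡_)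
open import Function.Bundles using (_⇔_)

nth : {A : Set} → List A → ℕ → Maybe A
nth []       _       = nothing
nth (x ∷ xs) zero    = just x
nth (x ∷ xs) (suc n) = nth xs n

record Partition : Set where
  field
    parts : List ℕ
    decr  : Linked _≥_ parts
    pos   : All (λ x → 0 < x) parts
open Partition public

partAt : List ℕ → ℕ → ℕ
partAt []       _       = 0
partAt (x ∷ xs) zero    = x
partAt (x ∷ xs) (suc n) = partAt xs n

-- cell (i , j) = (row , column), 0-indexed, lies in the Young diagram
InDiag : Partition → ℕ → ℕ → Set
InDiag p i j = j < partAt (parts p) i

size : Partition → ℕ
size p = sum (parts p)

_⊆ₚ_ : Partition → Partition → Set
μ ⊆ₚ ν = ∀ i j → InDiag μ i j → InDiag ν i j

_⊊ₚ_ : Partition → Partition → Set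
μ ⊊ₚ ν = μ ⊆ₚ ν × ¬ (parts μ ≡ parts ν)

FCell : Set
FCell = ℕ × ℕ × ℕ

row col entry : FCell → ℕ
row (i , j , a) = i
col (i , j , a) = j
entry (i , j , a) = a

pos2 : FCell → ℕ × ℕ
pos2 (i , j , a) = (i , j)

_≟ᶜ_ : (c d : FCell) → Relation.Nullary.Dec (c ≡ d)
_≟ᶜ_ = ≡-dec _≟_ (≡-dec _≟_ _≟_)

-- A tableau T^(i), regarded as a (duplicate-free) list of cells with entries
Block : Set
Block = List FCell

Semistandard : Block → Set
Semistandard B =
  (∀ c d → c ∈ B → d ∈ B → row c ≡ row d → col c < col d → entry c ≤ entry d)
  × (∀ c d → c ∈ B → d ∈ B → col c ≡ col d → row c < row d → entry c < entry d)

SSYT : Partition → Partition → Block → Set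
SSYT ν ρ B =
  All (λ c → 0 < entry c) B
  × Unique (map pos2 B)
  × (∀ i j → ((i , j) ∈ map pos2 B) ⇔ (InDiag ν i j × ¬ InDiag ρ i j))
  × Semistandard B

-- X_μ^λ : T = (T^(1), …, T^(k)) together with a chain μ = λ₀ ⊊ … ⊊ λₖ = λ
-- such that T^(i) ∈ SSYT(λᵢ / λᵢ₋₁)

ValidFrom : Partition → List Block → Partition → Set
ValidFrom ρ []       lam = parts ρ ≡ parts lam
ValidFrom ρ (B ∷ Bs) lam = Σ[ ν ∈ Partition ] (ρ ⊊ₚ ν × SSYT ν ρ B × ValidFrom ν Bs lam)

InX : Partition → Partition → List Block → Set
InX mu lam T = ValidFrom mu T lam

_≺_ : FCell → FCell → Set
c ≺ d = (entry c < entry d)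
      ⊎ (entry c ≡ entry d × col c < col d)
      ⊎ (entry c ≡ entry d × col c ≡ col d × row d < row c)

_≼_ : FCell → FCell → Set
c ≼ d = c ≡ d ⊎ c ≺ d

-- Splittable / mergeable cells (block index i is 0-indexed)

Splittable : List Block → ℕ → FCell → Set
Splittable T i c =
  Σ[ B ∈ Block ] (nth T i ≡ just B × c ∈ B × 1 < length B × (∀ d → d ∈ B → d ≼ c))

Mergeable : List Block → ℕ → FCell → Set
Mergeable T i c =
  Σ[ j ∈ ℕ ] (i ≡ suc j × nth T i ≡ just (c ∷ [])
    × Σ[ B′ ∈ Block ] (nth T j ≡ just B′ × Semistandard (B′ ++ c ∷ [])
                       × (∀ d → d ∈ B′ → d ≺ c)))

Candidate : List Block → ℕ → FCell → Set
Candidate T i c = Splittable T i c ⊎ Mergeable T i c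

splitBlock : ℕ → FCell → List Block → List Block
splitBlock _       c []       = []
splitBlock zero    c (B ∷ Bs) = filter (λ d → ¬? (d ≟ᶜ c)) B ∷ (c ∷ []) ∷ Bs
splitBlock (suc n) c (B ∷ Bs) = B ∷ splitBlock n c Bs

mergeBlocks : ℕ → List Block → List Block
mergeBlocks zero    (B ∷ B′ ∷ Bs) = (B ++ B′) ∷ Bs
mergeBlocks (suc n) (B ∷ Bs)      = B ∷ mergeBlocks n Bs
mergeBlocks _       Bs            = Bs

-- The graph of Φ : PhiGraph T T′ means Φ(T) = T′.
data PhiGraph (T : List Block) : List Block → Set where
  noCell  : (∀ i c → ¬ Splittable T i c) → (∀ i c → ¬ Mergeable T i c) →
            PhiGraph T T
  doSplit : ∀ i c → Splittable T i c →
            (∀ i′ c′ → Candidate T i′ c′ → c′ ≼ c) →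
            PhiGraph T (splitBlock i c T)
  doMerge : ∀ j c → Mergeable T (suc j) c →
            (∀ i′ c′ → Candidate T i′ c′ → c′ ≼ c) →
            PhiGraph T (mergeBlocks j T)

-- equality of elements of X (each tableau is a set of cells with entries)
_≈T_ : List Block → List Block → Set
T ≈T T′ = Pointwise _↭_ T T′

IsFixedPoint : List Block → Set
IsFixedPoint T = Σ[ T′ ∈ List Block ] (PhiGraph T T′ × T′ ≈T T)

F1 : Partition → Partition → List Block → Set
F1 mu lam T = length T ≡ size lam Data.Nat.∸ size mu

-- cells enumerated c₁ < … < cₙ; then c_{ℓ-i+1} ∈ T^(i)  (here 0-indexed:
-- block i contains cs[ℓ - 1 - i])
F2 : List Block → Set
F2 T = Σ[ cs ∈ List FCell ] (cs ↭ concat T × Linked _≺_ cs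
         × (∀ i B → nth T i ≡ just B →
              Σ[ c ∈ FCell ] (nth cs (length T Data.Nat.∸ suc i) ≡ just c × c ∈ B)))

-- Φ changes the number of tableaux whenever it moves a cell, so T is fixed exactly when no cell is
-- splittable or mergeable. Each T⁽ⁱ⁾ is nonempty because the chain is strict, and the T⁽ⁱ⁾ together
-- contain |λ| - |μ| cells; hence "no splittable cell" ⇔ "every T⁽ⁱ⁾ is a single cell" ⇔ (F1).
-- For one-cell tableaux T⁽ⁱ⁾ = {cᵢ}, the cell cᵢ₊₁ lies outside λᵢ while cᵢ lies inside, so cᵢ₊₁ is not
-- weakly north-west of cᵢ. Then cᵢ < cᵢ₊₁ would make {cᵢ, cᵢ₊₁} semistandard and cᵢ₊₁ mergeable; so
-- "no mergeable cell" ⇔ c₁ > c₂ > ⋯, which is (F2) with the cells listed in reverse.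
module Submission where

open import Defs
open import Data.List using (List; []; _∷_; [_]; map; length; concat; _++_; _ʳ++_; reverse; upTo)
open import Data.List.Properties using (length-++; length-map; length-upTo; concat-map-[_])
open import Data.List.Membership.Propositional using (_∈_)
open import Data.List.Membership.Propositional.Properties
  using (∈-map⁺; ∈-map⁻; ∈-++⁺ˡ; ∈-++⁺ʳ; ∈-++⁻; ∈-upTo⁺; ∈-upTo⁻)
open import Data.List.Membership.Propositional.Properties.WithK using (unique∧set⇒bag)
open import Data.List.Relation.Binary.BagAndSetEquality using (∼bag⇒↭)
open import Data.List.Relation.Binary.Permutation.Propositional using (_↭_; ↭-refl)
open import Data.List.Relation.Binary.Permutation.Propositional.Properties using (↭-length; ↭-reverse)
open import Data.List.Relation.Binary.Pointwise using (Pointwise-length) renaming (refl to Pointwise-refl)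
open import Data.List.Relation.Unary.All using (All; []; _∷_)
open import Data.List.Relation.Unary.Any using (here; there)
open import Data.List.Relation.Unary.Linked using (Linked; []; [-]; _∷_)
open import Data.List.Relation.Unary.Unique.Propositional using (Unique)
open import Data.List.Relation.Unary.AllPairs using ([])
import Data.List.Relation.Unary.Unique.Propositional.Properties as Unique
open import Data.Maybe using (just)
open import Data.Nat using (ℕ; zero; suc; _+_; _∸_; _<_; _≤_; _≥_; _≤′_; ≤′-refl; ≤′-step; z≤n; s≤s; _<?_)
open import Data.Nat.ListAction using (sum)
open import Data.Nat.Properties
open import Data.Empty using (⊥; ⊥-elim)
open import Data.Product using (Σ-syntax; ∃-syntax; _×_; _,_; proj₁; proj₂; map₁)
open import Data.Sum using (_⊎_; inj₁; inj₂)
open import Function using (flip; _∘_)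
open import Function.Bundles using (_⇔_; mk⇔; Equivalence)
open import Relation.Binary using (tri<; tri≈; tri>)
open import Relation.Binary.PropositionalEquality using (_≡_; _≢_; refl; sym; trans; cong; cong₂; subst; module ≡-Reasoning)
open import Relation.Nullary using (¬_; Dec; yes; no)

≤-from-< : ∀ {m n} → (∀ {k} → k < m → k < n) → m ≤ n
≤-from-< {zero}  _   = z≤n
≤-from-< {suc m} m<n = m<n ≤-refl

m<n⇒n∸m≡1+n∸1+m : ∀ {m n} → m < n → n ∸ m ≡ suc (n ∸ suc m)
m<n⇒n∸m≡1+n∸1+m {n = suc n} (s≤s m≤n) = +-∸-assoc 1 m≤n

unique-sameMembers⇒length≡ : ∀ {A : Set} {xs ys : List A} → Unique xs → Unique ys →
                             (∀ {x} → x ∈ xs ⇔ x ∈ ys) → length xs ≡ length ys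
unique-sameMembers⇒length≡ xs! ys! xs≈ys = ↭-length (∼bag⇒↭ (unique∧set⇒bag xs! ys! xs≈ys))

nth-length : ∀ {A : Set} (xs : List A) i {x} → nth xs i ≡ just x → i < length xs
nth-length (_ ∷ _)  zero    _  = s≤s z≤n
nth-length (_ ∷ xs) (suc i) eq = s≤s (nth-length xs i eq)

nth-ʳ++-length : ∀ {A : Set} (xs ys : List A) k → nth (xs ʳ++ ys) (k + length xs) ≡ nth ys k
nth-ʳ++-length []       ys k = cong (nth ys) (+-identityʳ k)
nth-ʳ++-length (x ∷ xs) ys k =
  trans (cong (nth (xs ʳ++ x ∷ ys)) (+-suc k (length xs))) (nth-ʳ++-length xs (x ∷ ys) (suc k))

nth-ʳ++ : ∀ {A : Set} (xs ys : List A) i {x} → nth xs i ≡ just x → nth (xs ʳ++ ys) (length xs ∸ suc i) ≡ just x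
nth-ʳ++ (y ∷ xs) ys zero    refl = nth-ʳ++-length xs (y ∷ ys) 0
nth-ʳ++ (y ∷ xs) ys (suc i) eq   = nth-ʳ++ xs (y ∷ ys) i eq

nth-reverse : ∀ {A : Set} (xs : List A) i {x} → nth xs i ≡ just x → nth (reverse xs) (length xs ∸ suc i) ≡ just x
nth-reverse xs = nth-ʳ++ xs []

Linked-ʳ++ : ∀ {A : Set} {R : A → A → Set} {x} xs {ys} →
             Linked (flip R) (x ∷ xs) → Linked R (x ∷ ys) → Linked R (xs ʳ++ x ∷ ys)
Linked-ʳ++ []       _           acc = acc
Linked-ʳ++ (_ ∷ xs) (Ryx ∷ xs↓) acc = Linked-ʳ++ xs xs↓ (Ryx ∷ acc)

Linked-reverse : ∀ {A : Set} {R : A → A → Set} {xs} → Linked (flip R) xs → Linked R (reverse xs)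
Linked-reverse {xs = []}     _   = []
Linked-reverse {xs = _ ∷ xs} xs↓ = Linked-ʳ++ xs xs↓ [-]

Linked-nth : ∀ {A : Set} {R : A → A → Set} {xs} → Linked R xs →
             ∀ k {x y} → nth xs k ≡ just x → nth xs (suc k) ≡ just y → R x y
Linked-nth (Rxy ∷ _)  zero    refl refl = Rxy
Linked-nth (_ ∷ rest) (suc k) eqx  eqy  = Linked-nth rest k eqx eqy

-- The order on cells

≺-irrefl : ∀ {c} → ¬ c ≺ c
≺-irrefl (inj₁ a<a)                 = <-irrefl refl a<a
≺-irrefl (inj₂ (inj₁ (_ , j<j)))     = <-irrefl refl j<j
≺-irrefl (inj₂ (inj₂ (_ , _ , i<i))) = <-irrefl refl i<i

≺-trans : ∀ {c d e} → c ≺ d → d ≺ e → c ≺ e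
≺-trans (inj₁ p)                        (inj₁ q)                        = inj₁ (<-trans p q)
≺-trans (inj₁ p)                        (inj₂ (inj₁ (refl , _)))        = inj₁ p
≺-trans (inj₁ p)                        (inj₂ (inj₂ (refl , _)))        = inj₁ p
≺-trans (inj₂ (inj₁ (refl , _)))        (inj₁ q)                        = inj₁ q
≺-trans (inj₂ (inj₂ (refl , _)))        (inj₁ q)                        = inj₁ q
≺-trans (inj₂ (inj₁ (refl , p)))        (inj₂ (inj₁ (refl , q)))        = inj₂ (inj₁ (refl , <-trans p q))
≺-trans (inj₂ (inj₁ (refl , p)))        (inj₂ (inj₂ (refl , refl , _))) = inj₂ (inj₁ (refl , p))
≺-trans (inj₂ (inj₂ (refl , refl , _))) (inj₂ (inj₁ (refl , q)))        = inj₂ (inj₁ (refl , q))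
≺-trans (inj₂ (inj₂ (refl , refl , p))) (inj₂ (inj₂ (refl , refl , q))) = inj₂ (inj₂ (refl , refl , <-trans q p))

≺-asym : ∀ {c d} → c ≺ d → ¬ d ≺ c
≺-asym p q = ≺-irrefl (≺-trans p q)

≺-trichotomy : ∀ c d → c ≺ d ⊎ c ≡ d ⊎ d ≺ c
≺-trichotomy (i , j , a) (i′ , j′ , a′) with <-cmp a a′
... | tri< a<a′ _ _ = inj₁ (inj₁ a<a′)
... | tri> _ _ a′<a = inj₂ (inj₂ (inj₁ a′<a))
... | tri≈ _ refl _ with <-cmp j j′
...   | tri< j<j′ _ _ = inj₁ (inj₂ (inj₁ (refl , j<j′)))
...   | tri> _ _ j′<j = inj₂ (inj₂ (inj₂ (inj₁ (refl , j′<j))))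
...   | tri≈ _ refl _ with <-cmp i i′
...     | tri< i<i′ _ _ = inj₂ (inj₂ (inj₂ (inj₂ (refl , refl , i<i′))))
...     | tri> _ _ i′<i = inj₁ (inj₂ (inj₂ (refl , refl , i′<i)))
...     | tri≈ _ refl _ = inj₂ (inj₁ refl)

≼-trans : ∀ {c d e} → c ≼ d → d ≼ e → c ≼ e
≼-trans (inj₁ refl) q           = q
≼-trans (inj₂ p)    (inj₁ refl) = inj₂ p
≼-trans (inj₂ p)    (inj₂ q)    = inj₂ (≺-trans p q)

∃-greatest : ∀ c cs → ∃[ m ] (m ∈ c ∷ cs × (∀ d → d ∈ c ∷ cs → d ≼ m))
∃-greatest c []        = c , here refl , λ { _ (here refl) → inj₁ refl }
∃-greatest c (c′ ∷ cs) with ∃-greatest c′ cs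
... | m , m∈ , m-max with ≺-trichotomy c m
...   | inj₁ c≺m         = m , there m∈ , λ { _ (here refl) → inj₂ c≺m ; d (there d∈) → m-max d d∈ }
...   | inj₂ (inj₁ refl) = m , there m∈ , λ { _ (here refl) → inj₁ refl ; d (there d∈) → m-max d d∈ }
...   | inj₂ (inj₂ m≺c)  =
  c , here refl , λ { _ (here refl) → inj₁ refl ; d (there d∈) → ≼-trans (m-max d d∈) (inj₂ m≺c) }

≺⇒entry≤ : ∀ {c d} → c ≺ d → entry c ≤ entry d
≺⇒entry≤ (inj₁ a<a′)             = <⇒≤ a<a′
≺⇒entry≤ (inj₂ (inj₁ (refl , _))) = ≤-refl
≺⇒entry≤ (inj₂ (inj₂ (refl , _))) = ≤-refl

≺-sameCol⇒entry< : ∀ {c d} → c ≺ d → col c ≡ col d → row c < row d → entry c < entry d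
≺-sameCol⇒entry< (inj₁ a<a′)                  _    _     = a<a′
≺-sameCol⇒entry< (inj₂ (inj₁ (_ , j<j′)))     refl _     = ⊥-elim (<-irrefl refl j<j′)
≺-sameCol⇒entry< (inj₂ (inj₂ (_ , _ , i′<i))) _    i<i′  = ⊥-elim (<-asym i<i′ i′<i)

-- Young diagrams

partAt[1+i]≤partAt[i] : ∀ {xs} → Linked _≥_ xs → ∀ i → partAt xs (suc i) ≤ partAt xs i
partAt[1+i]≤partAt[i] []         _       = z≤n
partAt[1+i]≤partAt[i] [-]        _       = z≤n
partAt[1+i]≤partAt[i] (x≥y ∷ _)  zero    = x≥y
partAt[1+i]≤partAt[i] (_ ∷ decr) (suc i) = partAt[1+i]≤partAt[i] decr i

partAt-antitone : ∀ {xs} → Linked _≥_ xs → ∀ {i j} → i ≤′ j → partAt xs j ≤ partAt xs i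
partAt-antitone decr ≤′-refl         = ≤-refl
partAt-antitone decr (≤′-step {j} p) = ≤-trans (partAt[1+i]≤partAt[i] decr j) (partAt-antitone decr p)

InDiag-downClosed : ∀ p {i j i′ j′} → InDiag p i j → i′ ≤ i → j′ ≤ j → InDiag p i′ j′
InDiag-downClosed p ij i′≤i j′≤j =
  ≤-trans (s≤s j′≤j) (≤-trans ij (partAt-antitone (decr p) (≤⇒≤′ i′≤i)))

InDiag? : ∀ p i j → Dec (InDiag p i j)
InDiag? p i j = j <? partAt (parts p) i

partAt-injective : ∀ {xs ys} → All (0 <_) xs → All (0 <_) ys →
                   (∀ i → partAt xs i ≡ partAt ys i) → xs ≡ ys
partAt-injective []          []          _  = refl
partAt-injective []          (0<y ∷ _)   eq = ⊥-elim (<-irrefl (eq 0) 0<y)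
partAt-injective (0<x ∷ _)   []          eq = ⊥-elim (<-irrefl (sym (eq 0)) 0<x)
partAt-injective (_ ∷ pos-x) (_ ∷ pos-y) eq =
  cong₂ _∷_ (eq 0) (partAt-injective pos-x pos-y (eq ∘ suc))

⊆ₚ-antisym : ∀ {μ ν} → μ ⊆ₚ ν → ν ⊆ₚ μ → parts μ ≡ parts ν
⊆ₚ-antisym {μ} {ν} μ⊆ν ν⊆μ = partAt-injective (pos μ) (pos ν) λ i →
  ≤-antisym (≤-from-< (μ⊆ν i _)) (≤-from-< (ν⊆μ i _))

inRow₀ : ℕ → ℕ × ℕ
inRow₀ j = (0 , j)

oneRowDown : ℕ × ℕ → ℕ × ℕ
oneRowDown = map₁ suc

cells : List ℕ → List (ℕ × ℕ)
cells []       = []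
cells (n ∷ ns) = map inRow₀ (upTo n) ++ map oneRowDown (cells ns)

length-cells : ∀ ns → length (cells ns) ≡ sum ns
length-cells []       = refl
length-cells (n ∷ ns) = begin
  length (map inRow₀ (upTo n) ++ map oneRowDown (cells ns))
    ≡⟨ length-++ (map inRow₀ (upTo n)) ⟩
  length (map inRow₀ (upTo n)) + length (map oneRowDown (cells ns))
    ≡⟨ cong₂ _+_ (trans (length-map _ (upTo n)) (length-upTo n))
                 (trans (length-map _ (cells ns)) (length-cells ns)) ⟩
  n + sum ns ∎
  where open ≡-Reasoning

∈-cells⁺ : ∀ ns {i j} → j < partAt ns i → (i , j) ∈ cells ns
∈-cells⁺ (n ∷ ns) {zero}  j<n = ∈-++⁺ˡ (∈-map⁺ inRow₀ (∈-upTo⁺ j<n))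
∈-cells⁺ (n ∷ ns) {suc i} j<m = ∈-++⁺ʳ (map inRow₀ (upTo n)) (∈-map⁺ oneRowDown (∈-cells⁺ ns j<m))

∈-cells⁻ : ∀ ns {i j} → (i , j) ∈ cells ns → j < partAt ns i
∈-cells⁻ (n ∷ ns) ij∈ with ∈-++⁻ (map inRow₀ (upTo n)) ij∈
... | inj₁ ∈row₀ with ∈-map⁻ inRow₀ ∈row₀
...   | _ , j∈ , refl = ∈-upTo⁻ j∈
∈-cells⁻ (n ∷ ns) ij∈ | inj₂ ∈below with ∈-map⁻ oneRowDown ∈below
...   | _ , ∈cells , refl = ∈-cells⁻ ns ∈cells

cells-unique : ∀ ns → Unique (cells ns)
cells-unique []       = []
cells-unique (n ∷ ns) =
  Unique.++⁺ (Unique.map⁺ (λ { refl → refl }) (Unique.upTo⁺ n))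
             (Unique.map⁺ (λ { {_ , _} {_ , _} refl → refl }) (cells-unique ns))
             λ { (∈row₀ , ∈below) → row₀-not-below (∈-map⁻ inRow₀ ∈row₀) (∈-map⁻ oneRowDown ∈below) }
  where
  row₀-not-below : ∀ {c} → ∃[ j ] (j ∈ upTo n × c ≡ inRow₀ j) → ∃[ c′ ] (c′ ∈ cells ns × c ≡ oneRowDown c′) → ⊥
  row₀-not-below (_ , _ , refl) (_ , _ , ())

-- Chains of skew tableaux

SSYT-length : ∀ {ν ρ B} → ρ ⊆ₚ ν → SSYT ν ρ B → size ρ + length B ≡ size ν
SSYT-length {ν} {ρ} {B} ρ⊆ν (_ , B-unique , skew , _) = begin
  size ρ + length B
    ≡⟨ sym (cong₂ _+_ (length-cells (parts ρ)) (length-map pos2 B)) ⟩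
  length (cells (parts ρ)) + length (map pos2 B)
    ≡⟨ sym (length-++ (cells (parts ρ))) ⟩
  length (cells (parts ρ) ++ map pos2 B)
    ≡⟨ unique-sameMembers⇒length≡ union-unique (cells-unique (parts ν)) (mk⇔ ⊆cells-ν cells-ν⊆) ⟩
  length (cells (parts ν))
    ≡⟨ length-cells (parts ν) ⟩
  size ν ∎
  where
  open ≡-Reasoning
  union-unique : Unique (cells (parts ρ) ++ map pos2 B)
  union-unique = Unique.++⁺ (cells-unique (parts ρ)) B-unique
    λ { {i , j} (∈ρ , ∈B) → proj₂ (Equivalence.to (skew i j) ∈B) (∈-cells⁻ (parts ρ) ∈ρ) }
  ⊆cells-ν : ∀ {c} → c ∈ cells (parts ρ) ++ map pos2 B → c ∈ cells (parts ν)
  ⊆cells-ν {i , j} c∈ with ∈-++⁻ (cells (parts ρ)) c∈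
  ... | inj₁ ∈ρ = ∈-cells⁺ (parts ν) (ρ⊆ν i j (∈-cells⁻ (parts ρ) ∈ρ))
  ... | inj₂ ∈B = ∈-cells⁺ (parts ν) (proj₁ (Equivalence.to (skew i j) ∈B))
  cells-ν⊆ : ∀ {c} → c ∈ cells (parts ν) → c ∈ cells (parts ρ) ++ map pos2 B
  cells-ν⊆ {i , j} ∈ν with InDiag? ρ i j
  ... | yes ij∈ρ = ∈-++⁺ˡ (∈-cells⁺ (parts ρ) ij∈ρ)
  ... | no  ij∉ρ = ∈-++⁺ʳ (cells (parts ρ)) (Equivalence.from (skew i j) (∈-cells⁻ (parts ν) ∈ν , ij∉ρ))

SSYT-nonempty : ∀ {ν ρ B} → ρ ⊊ₚ ν → SSYT ν ρ B → B ≢ []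
SSYT-nonempty {ν} {ρ} (ρ⊆ν , ρ≢ν) (_ , _ , skew , _) refl = ρ≢ν (⊆ₚ-antisym {ρ} {ν} ρ⊆ν ν⊆ρ)
  where
  ν⊆ρ : ν ⊆ₚ ρ
  ν⊆ρ i j ij∈ν with InDiag? ρ i j
  ... | yes ij∈ρ = ij∈ρ
  ... | no  ij∉ρ with () ← Equivalence.from (skew i j) (ij∈ν , ij∉ρ)

ValidFrom-size : ∀ {ρ T lam} → ValidFrom ρ T lam → size ρ + sum (map length T) ≡ size lam
ValidFrom-size {ρ} {[]}    ρ≡lam = trans (+-identityʳ (size ρ)) (cong sum ρ≡lam)
ValidFrom-size {ρ} {B ∷ T} {lam} (ν , (ρ⊆ν , _) , B-ssyt , rest) = begin
  size ρ + (length B + sum (map length T)) ≡⟨ sym (+-assoc (size ρ) (length B) _) ⟩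
  size ρ + length B + sum (map length T)   ≡⟨ cong (_+ sum (map length T)) (SSYT-length {ν} {ρ} ρ⊆ν B-ssyt) ⟩
  size ν + sum (map length T)              ≡⟨ ValidFrom-size rest ⟩
  size lam                                 ∎
  where open ≡-Reasoning

ValidFrom-nonempty : ∀ {ρ T lam} → ValidFrom ρ T lam → All (_≢ []) T
ValidFrom-nonempty {T = []}    _                         = []
ValidFrom-nonempty {ρ} {_ ∷ _} (ν , ρ⊊ν , B-ssyt , rest) =
  SSYT-nonempty {ν} {ρ} ρ⊊ν B-ssyt ∷ ValidFrom-nonempty rest

F1⇔length≡sum-length : ∀ mu lam {T} → InX mu lam T → F1 mu lam T ⇔ (length T ≡ sum (map length T))
F1⇔length≡sum-length mu lam {T} T∈X = mk⇔ (λ f1 → trans f1 cells-of-T) (λ eq → trans eq (sym cells-of-T))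
  where
  cells-of-T : size lam ∸ size mu ≡ sum (map length T)
  cells-of-T = trans (cong (_∸ size mu) (sym (ValidFrom-size T∈X))) (m+n∸m≡n (size mu) _)

WeaklyNW : FCell → FCell → Set
WeaklyNW c d = row c ≤ row d × col c ≤ col d

adjacent-¬WeaklyNW : ∀ {ν ρ ν′ B B′ a b} → SSYT ν ρ B → SSYT ν′ ν B′ → a ∈ B → b ∈ B′ → ¬ WeaklyNW b a
adjacent-¬WeaklyNW {ν} {a = a} {b} (_ , _ , skew , _) (_ , _ , skew′ , _) a∈ b∈ (rb≤ra , cb≤ca) =
  b∉ν (InDiag-downClosed ν a∈ν rb≤ra cb≤ca)
  where
  a∈ν : InDiag ν (row a) (col a)
  a∈ν = proj₁ (Equivalence.to (skew (row a) (col a)) (∈-map⁺ pos2 a∈))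
  b∉ν : ¬ InDiag ν (row b) (col b)
  b∉ν = proj₂ (Equivalence.to (skew′ (row b) (col b)) (∈-map⁺ pos2 b∈))

pair-semistandard : ∀ {a b} → ¬ WeaklyNW b a → a ≺ b → Semistandard (a ∷ b ∷ [])
pair-semistandard {a} {b} b⋠a a≺b = rows , columns
  where
  rows : ∀ c d → c ∈ a ∷ b ∷ [] → d ∈ a ∷ b ∷ [] → row c ≡ row d → col c < col d → entry c ≤ entry d
  rows _ _ (here refl)         (here refl)         _  j<j  = ⊥-elim (<-irrefl refl j<j)
  rows _ _ (here refl)         (there (here refl)) _  _    = ≺⇒entry≤ a≺b
  rows _ _ (there (here refl)) (here refl)         ≡r j<j′ = ⊥-elim (b⋠a (≤-reflexive ≡r , <⇒≤ j<j′))
  rows _ _ (there (here refl)) (there (here refl)) _  j<j  = ⊥-elim (<-irrefl refl j<j)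
  columns : ∀ c d → c ∈ a ∷ b ∷ [] → d ∈ a ∷ b ∷ [] → col c ≡ col d → row c < row d → entry c < entry d
  columns _ _ (here refl)         (here refl)         _  i<i  = ⊥-elim (<-irrefl refl i<i)
  columns _ _ (here refl)         (there (here refl)) ≡c i<i′ = ≺-sameCol⇒entry< a≺b ≡c i<i′
  columns _ _ (there (here refl)) (here refl)         ≡c i<i′ = ⊥-elim (b⋠a (<⇒≤ i<i′ , ≤-reflexive ≡c))
  columns _ _ (there (here refl)) (there (here refl)) _  i<i  = ⊥-elim (<-irrefl refl i<i)

¬WeaklyNW⇒≻-or-semistandard : ∀ {a b} → ¬ WeaklyNW b a → b ≺ a ⊎ (a ≺ b × Semistandard (a ∷ b ∷ []))
¬WeaklyNW⇒≻-or-semistandard {a} {b} b⋠a with ≺-trichotomy a b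
... | inj₁ a≺b         = inj₂ (a≺b , pair-semistandard b⋠a a≺b)
... | inj₂ (inj₁ refl) = ⊥-elim (b⋠a (≤-refl , ≤-refl))
... | inj₂ (inj₂ b≺a)  = inj₁ b≺a

-- Splitting and merging

NoSplittable NoMergeable : List Block → Set
NoSplittable T = ∀ i c → ¬ Splittable T i c
NoMergeable  T = ∀ i c → ¬ Mergeable T i c

length-splitBlock : ∀ T i c {B} → nth T i ≡ just B → length (splitBlock i c T) ≡ suc (length T)
length-splitBlock (_ ∷ T) zero    c _  = refl
length-splitBlock (_ ∷ T) (suc i) c eq = cong suc (length-splitBlock T i c eq)

length-mergeBlocks : ∀ T j {B} → nth T (suc j) ≡ just B → suc (length (mergeBlocks j T)) ≡ length T
length-mergeBlocks (_ ∷ _ ∷ T) zero    _  = refl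
length-mergeBlocks (_ ∷ T)     (suc j) eq = cong suc (length-mergeBlocks T j eq)

fixedPoint⇒noCandidate : ∀ T → IsFixedPoint T → NoSplittable T × NoMergeable T
fixedPoint⇒noCandidate T (_ , noCell noS noM , _) = noS , noM
fixedPoint⇒noCandidate T (_ , doSplit i c (_ , eq , _) _ , T′≈T) =
  ⊥-elim (1+n≢n (trans (sym (length-splitBlock T i c eq)) (Pointwise-length T′≈T)))
fixedPoint⇒noCandidate T (_ , doMerge j c (_ , refl , eq , _) _ , T′≈T) =
  ⊥-elim (1+n≢n (trans (length-mergeBlocks T j eq) (sym (Pointwise-length T′≈T))))

noCandidate⇒fixedPoint : ∀ {T} → NoSplittable T → NoMergeable T → IsFixedPoint T
noCandidate⇒fixedPoint {T} noS noM = T , noCell noS noM , Pointwise-refl ↭-refl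

noSplittable-tail : ∀ {B T} → NoSplittable (B ∷ T) → NoSplittable T
noSplittable-tail noS i = noS (suc i)

noMergeable-tail : ∀ {B T} → NoMergeable (B ∷ T) → NoMergeable T
noMergeable-tail noM i c (j , refl , rest) = noM (suc i) c (suc j , refl , rest)

-- One-cell tableaux

nth-singletons : ∀ (xs : List FCell) i {B} → nth (map [_] xs) i ≡ just B → ∃[ x ] (nth xs i ≡ just x × B ≡ [ x ])
nth-singletons (x ∷ _)  zero    refl = x , refl , refl
nth-singletons (_ ∷ xs) (suc i) eq   = nth-singletons xs i eq

singletons-noSplittable : ∀ (xs : List FCell) → NoSplittable (map [_] xs)
singletons-noSplittable xs i c (_ , eq , _ , 1<∣B∣ , _) with nth-singletons xs i eq
... | _ , _ , refl = <-irrefl refl 1<∣B∣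

noSplittable⇒singletons : ∀ {T} → All (_≢ []) T → NoSplittable T → ∃[ xs ] T ≡ map [_] xs
noSplittable⇒singletons                     []         _   = [] , refl
noSplittable⇒singletons {[] ∷ _}            (B≢[] ∷ _) _   = ⊥-elim (B≢[] refl)
noSplittable⇒singletons {(x ∷ []) ∷ _}      (_ ∷ ne)   noS
  with xs , refl ← noSplittable⇒singletons ne (noSplittable-tail noS) = x ∷ xs , refl
noSplittable⇒singletons {(x ∷ y ∷ B) ∷ _}   _          noS
  with m , m∈ , m-max ← ∃-greatest x (y ∷ B) =
    ⊥-elim (noS 0 m (x ∷ y ∷ B , refl , m∈ , s≤s (s≤s z≤n) , m-max))

length≤sum-length : ∀ {T : List Block} → All (_≢ []) T → length T ≤ sum (map length T)
length≤sum-length                []         = z≤n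
length≤sum-length {[] ∷ _}      (B≢[] ∷ _) = ⊥-elim (B≢[] refl)
length≤sum-length {(_ ∷ B) ∷ _} (_ ∷ ne)   = s≤s (≤-trans (length≤sum-length ne) (m≤n+m _ (length B)))

length≡sum-length⇒singletons : ∀ {T} → All (_≢ []) T → length T ≡ sum (map length T) → ∃[ xs ] T ≡ map [_] xs
length≡sum-length⇒singletons                   []         _  = [] , refl
length≡sum-length⇒singletons {[] ∷ _}          (B≢[] ∷ _) _  = ⊥-elim (B≢[] refl)
length≡sum-length⇒singletons {(x ∷ []) ∷ _}    (_ ∷ ne)   eq
  with xs , refl ← length≡sum-length⇒singletons ne (suc-injective eq) = x ∷ xs , refl
length≡sum-length⇒singletons {(_ ∷ _ ∷ B) ∷ T} (_ ∷ ne)   eq =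
  ⊥-elim (<⇒≢ (s≤s (≤-trans (length≤sum-length ne) (m≤n+m _ (length B)))) (suc-injective eq))

length≡sum-length-singletons : ∀ (xs : List FCell) → length (map [_] xs) ≡ sum (map length (map [_] xs))
length≡sum-length-singletons []       = refl
length≡sum-length-singletons (_ ∷ xs) = cong suc (length≡sum-length-singletons xs)

singletons-decreasing : ∀ {ρ lam} xs → ValidFrom ρ (map [_] xs) lam → NoMergeable (map [_] xs) →
                        Linked (flip _≺_) xs
singletons-decreasing []           _ _ = []
singletons-decreasing (_ ∷ [])     _ _ = [-]
singletons-decreasing {ρ} {lam} (a ∷ b ∷ xs) (ν , _ , a-ssyt , rest@(ν′ , _ , b-ssyt , _)) noM =
  b≺a ∷ singletons-decreasing {ν} {lam} (b ∷ xs) rest (noMergeable-tail noM)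
  where
  b≺a : b ≺ a
  b≺a with ¬WeaklyNW⇒≻-or-semistandard (adjacent-¬WeaklyNW {ν} {ρ} {ν′} a-ssyt b-ssyt (here refl) (here refl))
  ... | inj₁ b≺a             = b≺a
  ... | inj₂ (a≺b , ab-ssyt) =
    ⊥-elim (noM 1 b (0 , refl , refl , [ a ] , refl , ab-ssyt , λ { _ (here refl) → a≺b }))

decreasing⇒F2 : ∀ {xs} → Linked (flip _≺_) xs → F2 (map [_] xs)
decreasing⇒F2 {xs} xs↓ = reverse xs , reverse-↭-concat , Linked-reverse xs↓ , blocks
  where
  reverse-↭-concat : reverse xs ↭ concat (map [_] xs)
  reverse-↭-concat = subst (reverse xs ↭_) (sym (concat-map-[_] xs)) (↭-reverse xs)
  blocks : ∀ i B → nth (map [_] xs) i ≡ just B →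
           Σ[ c ∈ FCell ] (nth (reverse xs) (length (map [_] xs) ∸ suc i) ≡ just c × c ∈ B)
  blocks i _ eq with x , eq′ , refl ← nth-singletons xs i eq =
    x , subst (λ n → nth (reverse xs) (n ∸ suc i) ≡ just x) (sym (length-map [_] xs)) (nth-reverse xs i eq′) ,
    here refl

F2⇒noMergeable : ∀ T → F2 T → NoMergeable T
F2⇒noMergeable T (cs , _ , cs↑ , blocks) .(suc j) c (j , refl , eq , B′ , eq′ , _ , B′≺c)
  with blocks (suc j) [ c ] eq | blocks j B′ eq′
... | _ , at-c , here refl | c′ , at-c′ , c′∈B′ =
  -- in cs, the cell c of block suc j immediately precedes the cell c′ of block j
  ≺-asym (B′≺c c′ c′∈B′) (Linked-nth cs↑ (length T ∸ suc (suc j)) at-c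
    (subst (λ k → nth cs k ≡ just c′) (m<n⇒n∸m≡1+n∸1+m (nth-length T (suc j) eq)) at-c′))

lemma2p4 : (mu lam : Partition) → mu ⊆ₚ lam → (T : List Block) → InX mu lam T →
    (IsFixedPoint T ⇔ (F1 mu lam T × F2 T))
-- The hypothesis mu ⊆ₚ lam is implied by InX mu lam T.
lemma2p4 mu lam _ T T∈X = mk⇔ fixed⇒F1×F2 F1×F2⇒fixed
  where
  nonempty : All (_≢ []) T
  nonempty = ValidFrom-nonempty T∈X
  F1⇔ : F1 mu lam T ⇔ (length T ≡ sum (map length T))
  F1⇔ = F1⇔length≡sum-length mu lam T∈X
  fixed⇒F1×F2 : IsFixedPoint T → F1 mu lam T × F2 T
  fixed⇒F1×F2 fixed
    with noS , noM ← fixedPoint⇒noCandidate T fixed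
    with xs , refl ← noSplittable⇒singletons nonempty noS =
      Equivalence.from F1⇔ (length≡sum-length-singletons xs) , decreasing⇒F2 (singletons-decreasing xs T∈X noM)
  F1×F2⇒fixed : F1 mu lam T × F2 T → IsFixedPoint T
  F1×F2⇒fixed (f1 , f2)
    with xs , refl ← length≡sum-length⇒singletons nonempty (Equivalence.to F1⇔ f1) =
      noCandidate⇒fixedPoint (singletons-noSplittable xs) (F2⇒noMergeable (map [_] xs) f2)
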